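{- Let $\Phi_n$ be the QBF $\forall u_1\forall u_2\cdots\forall u_n.\ (u_1\vee u_2\vee\cdots\vee u_n)$. Every unary Q-SoS refutation of $\Phi_n$ has a number of monomials exponential in $n$.
   Context: A QBF $\mathcal Q.\phi$ consists of a quantifier prefix $\mathcal Q$ over a finite set $V$ of Boolean variables (each quantified once, existentially or universally, in a linear order) and a CNF $\phi$ over $V$. For each $v\in V$ let $\overline v$ be a new formal variable (its twin); polynomials live in $\mathbb Q[V\cup\overline V]$. A clause $C=\bigvee_{v\in P}v\vee\bigvee_{v\in N}\neg v$ is encoded as $\mathrm{enc}(C)=\{\prod_{v\in P}\overline v\prod_{v\in N}v\}\cup\{v^2-v,\ v+\overline v-1: v\in P\cup N\}$, and $\mathrm{enc}(\phi)=\bigcup_{C\in\phi}\mathrm{enc}(C)$. A Q-SoS refutation of $\mathcal Q.\phi$ is a polynomial identity $\sum_{p\in \mathrm{enc}(\phi)}q_pp+\sum_{u}q_u(1-2u)+q+1=0$, where $u$ ranges over universally quantified variables, every variable $v$ or $\overline v$ occurring in $q_u$ has $v$ quantified to the left of $u$, and $q$ is a sum of squares of polynomials. The refutation is unary if all the polynomials involved ($q_p$, $q_u$ and the polynomials in $q$) are written as sums of monomials each having coefficient $+1$ or $-1$ (monomials may repeat); its number of monomials is counted with repetition. -}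

module Defs where

open import Data.Nat using (ℕ; zero; suc; _≤_)
open import Data.Bool using (Bool; true; false)
open import Data.Fin using (Fin; toℕ)
open import Data.List using (List; []; _∷_; _++_; map; concatMap; concat; length; allFin)
open import Data.Nat.ListAction using (sum)
open import Data.Vec using (Vec; replicate; lookup; updateAt)
import Data.Vec.Properties as VecP
import Data.Nat.Properties as ℕP
open import Data.Product using (_×_; _,_; proj₁; proj₂)
open import Data.Product.Properties using (≡-dec)
open import Data.Rational using (ℚ; 0ℚ; 1ℚ; -_) renaming (_+_ to _+ℚ_; _*_ to _*ℚ_)
open import Relation.Nullary using (¬_; yes; no)
open import Relation.Binary.PropositionalEquality using (_≡_)

-- Polynomials in ℚ[u₁..uₙ, ū₁..ūₙ]
-- Variables: u_i (i : Fin n) and their twins ū_i.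
-- A monomial is an exponent vector: (exponents of u, exponents of ū).

Mono : ℕ → Set
Mono n = Vec ℕ n × Vec ℕ n

_≟M_ : ∀ {n} (e f : Mono n) → Relation.Nullary.Dec (e ≡ f)
_≟M_ = ≡-dec (VecP.≡-dec ℕP._≟_) (VecP.≡-dec ℕP._≟_)

_·M_ : ∀ {n} → Mono n → Mono n → Mono n
(a , b) ·M (c , d) = Data.Vec.zipWith ℕ._+_ a c , Data.Vec.zipWith ℕ._+_ b d
  where import Data.Nat as ℕ

oneM : ∀ {n} → Mono n
oneM = replicate _ 0 , replicate _ 0

uM : ∀ {n} → Fin n → ℕ → Mono n
uM i k = updateAt (replicate _ 0) i (λ _ → k) , replicate _ 0

ubarM : ∀ {n} → Fin n → Mono n
ubarM i = replicate _ 0 , updateAt (replicate _ 0) i (λ _ → 1)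

-- A (formal) polynomial: a finite list of terms coefficient × monomial,
-- representing their sum (monomials may repeat).
Poly : ℕ → Set
Poly n = List (ℚ × Mono n)

_⊕_ : ∀ {n} → Poly n → Poly n → Poly n
_⊕_ = _++_

_⊗_ : ∀ {n} → Poly n → Poly n → Poly n
p ⊗ q = concatMap (λ { (a , e) → map (λ { (b , f) → (a *ℚ b , e ·M f) }) q }) p

coeff : ∀ {n} → Poly n → Mono n → ℚ
coeff [] e = 0ℚ
coeff ((a , f) ∷ p) e with f ≟M e
... | yes _ = a +ℚ coeff p e
... | no  _ = coeff p e

IsZero : ∀ {n} → Poly n → Set
IsZero p = ∀ e → coeff p e ≡ 0ℚ

-- e mentions only variables u_j, ū_j with j < i (quantified left of u_i)
OnlyLeftOf : ∀ {n} → Fin n → Mono n → Set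
OnlyLeftOf {n} i e = ∀ (j : Fin n) → toℕ i ≤ toℕ j →
  (lookup (proj₁ e) j ≡ 0) × (lookup (proj₂ e) j ≡ 0)

-- Unary polynomials: sums of monomials with coefficient +1 (true) or -1 (false)

UPoly : ℕ → Set
UPoly n = List (Bool × Mono n)

toPoly : ∀ {n} → UPoly n → Poly n
toPoly = map (λ { (true , e) → (1ℚ , e) ; (false , e) → (- 1ℚ , e) })

-- Φₙ = ∀u₁ … ∀uₙ. (u₁ ∨ … ∨ uₙ).  Its single clause has P = {u₁..uₙ}, N = ∅,
-- so enc(Φₙ) = {∏ᵢ ūᵢ} ∪ {uᵢ² − uᵢ , uᵢ + ūᵢ − 1 : i}.

data Gen (n : ℕ) : Set where
  clause : Gen n
  boolAx : Fin n → Gen n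
  compAx : Fin n → Gen n

allGen : (n : ℕ) → List (Gen n)
allGen n = clause ∷ (map boolAx (allFin n) ++ map compAx (allFin n))

gen : ∀ {n} → Gen n → Poly n
gen {n} clause = (1ℚ , (replicate n 0 , replicate n 1)) ∷ []
gen (boolAx i) = (1ℚ , uM i 2) ∷ (- 1ℚ , uM i 1) ∷ []
gen (compAx i) = (1ℚ , uM i 1) ∷ (1ℚ , ubarM i) ∷ (- 1ℚ , oneM) ∷ []

oneMinus2u : ∀ {n} → Fin n → Poly n
oneMinus2u i = (1ℚ , oneM) ∷ (- (1ℚ +ℚ 1ℚ) , uM i 1) ∷ []

sumPoly : ∀ {n} → List (Poly n) → Poly n
sumPoly = concat

record UnaryRefutation (n : ℕ) : Set where
  field
    qgen    : Gen n → UPoly n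
    quni    : Fin n → UPoly n
    squares : List (UPoly n)
    quni-ok : ∀ i e → ¬ (coeff (toPoly (quni i)) e ≡ 0ℚ) → OnlyLeftOf i e
    identity :
      IsZero (sumPoly (map (λ g → toPoly (qgen g) ⊗ gen g) (allGen n))
            ⊕ (sumPoly (map (λ i → toPoly (quni i) ⊗ oneMinus2u i) (allFin n))
            ⊕ (sumPoly (map (λ s → toPoly s ⊗ toPoly s) squares)
            ⊕ ((1ℚ , oneM) ∷ []))))

  -- number of monomials, counted with repetition
  size : ℕ
  size = sum (map (λ g → length (qgen g)) (allGen n))
       Data.Nat.+ (sum (map (λ i → length (quni i)) (allFin n))
       Data.Nat.+ sum (map length squares))
    where import Data.Nat

-- Evaluate the refutation at every Boolean point (uᵢ = aᵢ, ūᵢ = ¬aᵢ) and add up over the whole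
-- cube {0,1}ⁿ. Every Boolean and complement axiom vanishes pointwise, and the clause ∏ ūᵢ is the
-- indicator of the all-false point, so its term contributes q_clause(0,…,0). Each term
-- q_u (1 − 2u) cancels, because q_u does not depend on u and 1 − 2u takes opposite values at the
-- two points differing only in u. The squares contribute a non-negative amount and the constant 1
-- contributes 2ⁿ. Hence q_clause(0,…,0) ≤ −2ⁿ; but a sum of L monomials with coefficients ±1 is at
-- least −L at any Boolean point, so q_clause alone already has 2ⁿ monomials.
module Submission where

open import Defs
open import Data.Nat using (ℕ; _≤_; _*_; _^_)
open import Data.Product using (∃-syntax)

open import Algebra.Bundles using (CommutativeMonoid)
import Algebra.Properties.CommutativeSemigroup as CommutativeSemigroupProperties
import Algebra.Properties.Group as GroupProperties
open import Data.Bool using (Bool; true; false; not)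
open import Data.Empty using (⊥-elim)
open import Data.Fin using (Fin; zero; suc)
open import Data.List using (List; []; _∷_; _++_; map; concat; foldr; length; allFin)
open import Data.List.Properties using (map-cong)
open import Data.List.Relation.Unary.All as All using (All; []; _∷_)
open import Data.List.Relation.Unary.All.Properties using (++⁺; map⁺)
import Data.Nat as ℕ
import Data.Nat.Properties as ℕ
open import Data.Product using (_,_; proj₁; proj₂)
open import Data.Rational using (ℚ; 0ℚ; 1ℚ; -_; nonNegative; nonPositive)
  renaming (_+_ to _+ℚ_; _*_ to _*ℚ_; _≤_ to _≤ℚ_)
import Data.Rational.Properties as ℚ
open import Data.Sum using (_⊎_; inj₁; inj₂)
open import Data.Unit using (tt)
open import Data.Vec using (Vec; []; _∷_; replicate; lookup; _[_]≔_)
open import Relation.Nullary using (¬_; yes; no)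
open import Relation.Nullary.Decidable using (toWitness)
open import Relation.Binary.PropositionalEquality

open CommutativeSemigroupProperties (CommutativeMonoid.commutativeSemigroup ℚ.*-1-commutativeMonoid)
  using () renaming (interchange to *-interchange)
open CommutativeSemigroupProperties (CommutativeMonoid.commutativeSemigroup ℚ.+-0-commutativeMonoid)
  using () renaming (interchange to +-interchange)
open GroupProperties ℚ.+-0-group using (⁻¹-involutive; inverseʳ-unique; \\-leftDividesʳ)

sumℚ : List ℚ → ℚ
sumℚ = foldr _+ℚ_ 0ℚ

fromℕ : ℕ → ℚ
fromℕ ℕ.zero = 0ℚ
fromℕ (ℕ.suc k) = 1ℚ +ℚ fromℕ k

sumℚ-All-0 : ∀ {A : Set} (f : A → ℚ) {xs} → All (λ x → f x ≡ 0ℚ) xs → sumℚ (map f xs) ≡ 0ℚ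
sumℚ-All-0 f [] = refl
sumℚ-All-0 f (fx≡0 ∷ rest) = trans (cong₂ _+ℚ_ fx≡0 (sumℚ-All-0 f rest)) (ℚ.+-identityʳ 0ℚ)

sumℚ-nonNeg : ∀ {A : Set} (f : A → ℚ) xs → (∀ x → 0ℚ ≤ℚ f x) → 0ℚ ≤ℚ sumℚ (map f xs)
sumℚ-nonNeg f [] f≥0 = ℚ.≤-refl
sumℚ-nonNeg f (x ∷ xs) f≥0 = ℚ.+-mono-≤ (f≥0 x) (sumℚ-nonNeg f xs f≥0)

*-self-nonNeg : ∀ x → 0ℚ ≤ℚ x *ℚ x
*-self-nonNeg x with ℚ.≤-total x 0ℚ
... | inj₁ x≤0 = ℚ.nonNegative⁻¹ (x *ℚ x)
  {{ℚ.nonPos*nonPos⇒nonPos x {{nonPositive x≤0}} x {{nonPositive x≤0}}}}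
... | inj₂ 0≤x = ℚ.nonNegative⁻¹ (x *ℚ x)
  {{ℚ.nonNeg*nonNeg⇒nonNeg x {{nonNegative 0≤x}} x {{nonNegative 0≤x}}}}

+-cancelˡ-≤ : ∀ r {p q} → r +ℚ p ≤ℚ r +ℚ q → p ≤ℚ q
+-cancelˡ-≤ r {p} {q} r+p≤r+q = begin
  p                 ≡⟨ \\-leftDividesʳ r p ⟨
  - r +ℚ (r +ℚ p)   ≤⟨ ℚ.+-monoʳ-≤ (- r) r+p≤r+q ⟩
  - r +ℚ (r +ℚ q)   ≡⟨ \\-leftDividesʳ r q ⟩
  q                 ∎
  where open ℚ.≤-Reasoning

fromℕ-nonNeg : ∀ k → 0ℚ ≤ℚ fromℕ k
fromℕ-nonNeg ℕ.zero = ℚ.≤-refl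
fromℕ-nonNeg (ℕ.suc k) = ℚ.+-mono-≤ (toWitness {a? = 0ℚ ℚ.≤? 1ℚ} tt) (fromℕ-nonNeg k)

fromℕ-cancel-≤ : ∀ k l → fromℕ k ≤ℚ fromℕ l → k ≤ l
fromℕ-cancel-≤ ℕ.zero l _ = ℕ.z≤n
fromℕ-cancel-≤ (ℕ.suc k) ℕ.zero 1+k≤0 =
  ⊥-elim (ℚ.<-irrefl refl (ℚ.<-≤-trans 0<1+k 1+k≤0))
  where
  0<1+k : 0ℚ Data.Rational.< 1ℚ +ℚ fromℕ k
  0<1+k = ℚ.+-mono-<-≤ (toWitness {a? = 0ℚ ℚ.<? 1ℚ} tt) (fromℕ-nonNeg k)
fromℕ-cancel-≤ (ℕ.suc k) (ℕ.suc l) 1+k≤1+l = ℕ.s≤s (fromℕ-cancel-≤ k l (+-cancelˡ-≤ 1ℚ 1+k≤1+l))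

sum≡0⇒≤-neg : ∀ x s y → x +ℚ (s +ℚ y) ≡ 0ℚ → 0ℚ ≤ℚ s → y ≤ℚ - x
sum≡0⇒≤-neg x s y sum≡0 0≤s = begin
  y          ≡⟨ ℚ.+-identityˡ y ⟨
  0ℚ +ℚ y    ≤⟨ ℚ.+-monoˡ-≤ y 0≤s ⟩
  s +ℚ y     ≡⟨ inverseʳ-unique x (s +ℚ y) sum≡0 ⟩
  - x        ∎
  where open ℚ.≤-Reasoning

Valuation : ℕ → Set
Valuation n = Mono n → ℚ

Multiplicative : ∀ {n} → Valuation n → Set
Multiplicative F = ∀ e f → F (e ·M f) ≡ F e *ℚ F f

eval : ∀ {n} → Valuation n → Poly n → ℚ
eval F [] = 0ℚ
eval F ((c , e) ∷ p) = c *ℚ F e +ℚ eval F p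

module _ {n : ℕ} (F : Valuation n) where

  eval-++ : ∀ p q → eval F (p ++ q) ≡ eval F p +ℚ eval F q
  eval-++ [] q = sym (ℚ.+-identityˡ (eval F q))
  eval-++ ((c , e) ∷ p) q =
    trans (cong (c *ℚ F e +ℚ_) (eval-++ p q)) (sym (ℚ.+-assoc (c *ℚ F e) (eval F p) (eval F q)))

  eval-concat : ∀ {A : Set} (h : A → Poly n) xs → eval F (concat (map h xs)) ≡ sumℚ (map (λ x → eval F (h x)) xs)
  eval-concat h [] = refl
  eval-concat h (x ∷ xs) = trans (eval-++ (h x) _) (cong (eval F (h x) +ℚ_) (eval-concat h xs))

  module _ (F-mult : Multiplicative F) where

    eval-scale : ∀ c e q → eval F (map (λ { (b , f) → (c *ℚ b , e ·M f) }) q) ≡ (c *ℚ F e) *ℚ eval F q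
    eval-scale c e [] = sym (ℚ.*-zeroʳ (c *ℚ F e))
    eval-scale c e ((b , f) ∷ q) = begin
      (c *ℚ b) *ℚ F (e ·M f) +ℚ eval F (map (λ { (b , f) → (c *ℚ b , e ·M f) }) q)
        ≡⟨ cong₂ _+ℚ_ (trans (cong ((c *ℚ b) *ℚ_) (F-mult e f)) (*-interchange c b (F e) (F f)))
                      (eval-scale c e q) ⟩
      (c *ℚ F e) *ℚ (b *ℚ F f) +ℚ (c *ℚ F e) *ℚ eval F q
        ≡⟨ sym (ℚ.*-distribˡ-+ (c *ℚ F e) (b *ℚ F f) (eval F q)) ⟩
      (c *ℚ F e) *ℚ (b *ℚ F f +ℚ eval F q) ∎
      where open ≡-Reasoning

    eval-⊗ : ∀ p q → eval F (p ⊗ q) ≡ eval F p *ℚ eval F q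
    eval-⊗ [] q = sym (ℚ.*-zeroˡ (eval F q))
    eval-⊗ ((c , e) ∷ p) q = begin
      eval F (((c , e) ∷ p) ⊗ q)
        ≡⟨ eval-++ (map (λ { (b , f) → (c *ℚ b , e ·M f) }) q) (p ⊗ q) ⟩
      eval F (map (λ { (b , f) → (c *ℚ b , e ·M f) }) q) +ℚ eval F (p ⊗ q)
        ≡⟨ cong₂ _+ℚ_ (eval-scale c e q) (eval-⊗ p q) ⟩
      (c *ℚ F e) *ℚ eval F q +ℚ eval F p *ℚ eval F q
        ≡⟨ sym (ℚ.*-distribʳ-+ (eval F q) (c *ℚ F e) (eval F p)) ⟩
      (c *ℚ F e +ℚ eval F p) *ℚ eval F q ∎
      where open ≡-Reasoning

removeMono : ∀ {n} → Mono n → Poly n → Poly n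
removeMono f [] = []
removeMono f ((c , g) ∷ p) with g ≟M f
... | yes _ = removeMono f p
... | no _ = (c , g) ∷ removeMono f p

length-removeMono : ∀ {n} f (p : Poly n) → length (removeMono f p) ≤ length p
length-removeMono f [] = ℕ.z≤n
length-removeMono f ((c , g) ∷ p) with g ≟M f
... | yes _ = ℕ.m≤n⇒m≤1+n (length-removeMono f p)
... | no _ = ℕ.s≤s (length-removeMono f p)

coeff-∷-≢ : ∀ {n} c (f : Mono n) p e → ¬ f ≡ e → coeff ((c , f) ∷ p) e ≡ coeff p e
coeff-∷-≢ c f p e f≢e with f ≟M e
... | yes f≡e = ⊥-elim (f≢e f≡e)
... | no _ = refl

coeff-removeMono-≡ : ∀ {n} f (p : Poly n) → coeff (removeMono f p) f ≡ 0ℚ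
coeff-removeMono-≡ f [] = refl
coeff-removeMono-≡ f ((c , g) ∷ p) with g ≟M f
... | yes _ = coeff-removeMono-≡ f p
... | no g≢f = trans (coeff-∷-≢ c g (removeMono f p) f g≢f) (coeff-removeMono-≡ f p)

coeff-removeMono-≢ : ∀ {n} f (p : Poly n) e → ¬ f ≡ e → coeff (removeMono f p) e ≡ coeff p e
coeff-removeMono-≢ f [] e f≢e = refl
coeff-removeMono-≢ f ((c , g) ∷ p) e f≢e with g ≟M f
... | yes refl = trans (coeff-removeMono-≢ f p e f≢e) (sym (coeff-∷-≢ c g p e f≢e))
... | no _ with g ≟M e
...   | yes _ = cong (c +ℚ_) (coeff-removeMono-≢ f p e f≢e)
...   | no _ = coeff-removeMono-≢ f p e f≢e

eval-removeMono : ∀ {n} (F : Valuation n) f p → eval F p ≡ coeff p f *ℚ F f +ℚ eval F (removeMono f p)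
eval-removeMono F f [] = sym (trans (ℚ.+-identityʳ _) (ℚ.*-zeroˡ (F f)))
eval-removeMono F f ((c , g) ∷ p) with g ≟M f
eval-removeMono F f ((c , g) ∷ p) | yes refl = begin
  c *ℚ F g +ℚ eval F p
    ≡⟨ cong (c *ℚ F g +ℚ_) (eval-removeMono F g p) ⟩
  c *ℚ F g +ℚ (coeff p g *ℚ F g +ℚ eval F (removeMono g p))
    ≡⟨ sym (ℚ.+-assoc (c *ℚ F g) _ _) ⟩
  (c *ℚ F g +ℚ coeff p g *ℚ F g) +ℚ eval F (removeMono g p)
    ≡⟨ cong (_+ℚ eval F (removeMono g p)) (sym (ℚ.*-distribʳ-+ (F g) c (coeff p g))) ⟩
  (c +ℚ coeff p g) *ℚ F g +ℚ eval F (removeMono g p) ∎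
  where open ≡-Reasoning
eval-removeMono F f ((c , g) ∷ p) | no _ = begin
  c *ℚ F g +ℚ eval F p
    ≡⟨ cong (c *ℚ F g +ℚ_) (eval-removeMono F f p) ⟩
  c *ℚ F g +ℚ (coeff p f *ℚ F f +ℚ eval F (removeMono f p))
    ≡⟨ sym (ℚ.+-assoc (c *ℚ F g) _ _) ⟩
  (c *ℚ F g +ℚ coeff p f *ℚ F f) +ℚ eval F (removeMono f p)
    ≡⟨ cong (_+ℚ eval F (removeMono f p)) (ℚ.+-comm (c *ℚ F g) _) ⟩
  (coeff p f *ℚ F f +ℚ c *ℚ F g) +ℚ eval F (removeMono f p)
    ≡⟨ ℚ.+-assoc (coeff p f *ℚ F f) _ _ ⟩
  coeff p f *ℚ F f +ℚ (c *ℚ F g +ℚ eval F (removeMono f p)) ∎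
  where open ≡-Reasoning

AgreeOnSupport : ∀ {n} → Valuation n → Valuation n → Poly n → Set
AgreeOnSupport F G p = ∀ e → ¬ coeff p e ≡ 0ℚ → F e ≡ G e

-- Strong induction on the length: removing the first monomial f shortens p.
eval-cong-support-≤ : ∀ {n} (F G : Valuation n) k p → length p ≤ k →
  AgreeOnSupport F G p → eval F p ≡ eval G p
eval-cong-support-≤ F G k [] _ _ = refl
eval-cong-support-≤ F G (ℕ.suc k) p@((c , f) ∷ p′) (ℕ.s≤s |p′|≤k) agree = begin
  eval F p                                      ≡⟨ eval-removeMono F f p ⟩
  coeff p f *ℚ F f +ℚ eval F (removeMono f p)   ≡⟨ cong₂ _+ℚ_ agree-at-f agree-on-rest ⟩
  coeff p f *ℚ G f +ℚ eval G (removeMono f p)   ≡⟨ sym (eval-removeMono G f p) ⟩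
  eval G p                                      ∎
  where
  open ≡-Reasoning
  agree-at-f : coeff p f *ℚ F f ≡ coeff p f *ℚ G f
  agree-at-f with coeff p f ℚ.≟ 0ℚ
  ... | yes zero-coeff =
    trans (cong (_*ℚ F f) zero-coeff)
      (trans (ℚ.*-zeroˡ (F f)) (sym (trans (cong (_*ℚ G f) zero-coeff) (ℚ.*-zeroˡ (G f)))))
  ... | no nonzero-coeff = cong (coeff p f *ℚ_) (agree f nonzero-coeff)
  removeMono-head : removeMono f p ≡ removeMono f p′
  removeMono-head with f ≟M f
  ... | yes _ = refl
  ... | no f≢f = ⊥-elim (f≢f refl)
  agree-rest : AgreeOnSupport F G (removeMono f p′)
  agree-rest e nonzero with f ≟M e
  ... | yes refl = ⊥-elim (nonzero (coeff-removeMono-≡ f p′))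
  ... | no f≢e = agree e λ zero-coeff →
    nonzero (trans (coeff-removeMono-≢ f p′ e f≢e) (trans (sym (coeff-∷-≢ c f p′ e f≢e)) zero-coeff))
  agree-on-rest : eval F (removeMono f p) ≡ eval G (removeMono f p)
  agree-on-rest rewrite removeMono-head =
    eval-cong-support-≤ F G k (removeMono f p′) (ℕ.≤-trans (length-removeMono f p′) |p′|≤k) agree-rest

eval-cong-support : ∀ {n} (F G : Valuation n) p → AgreeOnSupport F G p → eval F p ≡ eval G p
eval-cong-support F G p = eval-cong-support-≤ F G (length p) p ℕ.≤-refl

eval-IsZero : ∀ {n} (F : Valuation n) p → IsZero p → eval F p ≡ 0ℚ
eval-IsZero F p p≡0 =
  trans (eval-cong-support F (λ _ → 0ℚ) p (λ e nonzero → ⊥-elim (nonzero (p≡0 e)))) (eval-const-zero p)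
  where
  eval-const-zero : ∀ q → eval (λ _ → 0ℚ) q ≡ 0ℚ
  eval-const-zero [] = refl
  eval-const-zero ((c , _) ∷ q) = trans (cong₂ _+ℚ_ (ℚ.*-zeroʳ c) (eval-const-zero q)) (ℚ.+-identityʳ 0ℚ)

bit : Bool → ℚ
bit true = 1ℚ
bit false = 0ℚ

zeroPow : ℕ → ℚ
zeroPow ℕ.zero = 1ℚ
zeroPow (ℕ.suc _) = 0ℚ

-- The factor uˣ ūʸ at u = b, ū = ¬b.
literal : Bool → ℕ → ℕ → ℚ
literal true x y = zeroPow y
literal false x y = zeroPow x

pointValue : ∀ {n} → Vec Bool n → Vec ℕ n → Vec ℕ n → ℚ
pointValue [] [] [] = 1ℚ
pointValue (b ∷ a) (x ∷ xs) (y ∷ ys) = literal b x y *ℚ pointValue a xs ys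

⟦_⟧ : ∀ {n} → Vec Bool n → Valuation n
⟦ a ⟧ (xs , ys) = pointValue a xs ys

zeroPow-+ : ∀ x y → zeroPow (x ℕ.+ y) ≡ zeroPow x *ℚ zeroPow y
zeroPow-+ ℕ.zero y = sym (ℚ.*-identityˡ (zeroPow y))
zeroPow-+ (ℕ.suc x) y = sym (ℚ.*-zeroˡ (zeroPow y))

literal-+ : ∀ b x y x′ y′ → literal b (x ℕ.+ x′) (y ℕ.+ y′) ≡ literal b x y *ℚ literal b x′ y′
literal-+ true x y x′ y′ = zeroPow-+ y y′
literal-+ false x y x′ y′ = zeroPow-+ x x′

literal-0-0 : ∀ b → literal b 0 0 ≡ 1ℚ
literal-0-0 true = refl
literal-0-0 false = refl

IsBit : ℚ → Set
IsBit v = v ≡ 0ℚ ⊎ v ≡ 1ℚ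

IsBit-* : ∀ {v w} → IsBit v → IsBit w → IsBit (v *ℚ w)
IsBit-* (inj₁ refl) (inj₁ refl) = inj₁ refl
IsBit-* (inj₁ refl) (inj₂ refl) = inj₁ refl
IsBit-* (inj₂ refl) (inj₁ refl) = inj₁ refl
IsBit-* (inj₂ refl) (inj₂ refl) = inj₂ refl

literal-IsBit : ∀ b x y → IsBit (literal b x y)
literal-IsBit true x ℕ.zero = inj₂ refl
literal-IsBit true x (ℕ.suc y) = inj₁ refl
literal-IsBit false ℕ.zero y = inj₂ refl
literal-IsBit false (ℕ.suc x) y = inj₁ refl

⟦⟧-multiplicative : ∀ {n} (a : Vec Bool n) → Multiplicative ⟦ a ⟧
⟦⟧-multiplicative [] ([] , []) ([] , []) = refl
⟦⟧-multiplicative (b ∷ a) (x ∷ xs , y ∷ ys) (x′ ∷ xs′ , y′ ∷ ys′) =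
  trans (cong₂ _*ℚ_ (literal-+ b x y x′ y′) (⟦⟧-multiplicative a (xs , ys) (xs′ , ys′)))
        (*-interchange (literal b x y) (literal b x′ y′) (⟦ a ⟧ (xs , ys)) (⟦ a ⟧ (xs′ , ys′)))

⟦⟧-IsBit : ∀ {n} (a : Vec Bool n) e → IsBit (⟦ a ⟧ e)
⟦⟧-IsBit [] ([] , []) = inj₂ refl
⟦⟧-IsBit (b ∷ a) (x ∷ xs , y ∷ ys) = IsBit-* (literal-IsBit b x y) (⟦⟧-IsBit a (xs , ys))

⟦⟧-oneM : ∀ {n} (a : Vec Bool n) → ⟦ a ⟧ oneM ≡ 1ℚ
⟦⟧-oneM [] = refl
⟦⟧-oneM (b ∷ a) = trans (cong₂ _*ℚ_ (literal-0-0 b) (⟦⟧-oneM a)) (ℚ.*-identityˡ 1ℚ)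

⟦⟧-uM : ∀ {n} (a : Vec Bool n) i k → ⟦ a ⟧ (uM i (ℕ.suc k)) ≡ bit (lookup a i)
⟦⟧-uM (true ∷ a) zero k = trans (ℚ.*-identityˡ _) (⟦⟧-oneM a)
⟦⟧-uM (false ∷ a) zero k = ℚ.*-zeroˡ (⟦ a ⟧ oneM)
⟦⟧-uM (b ∷ a) (suc i) k =
  trans (cong (_*ℚ ⟦ a ⟧ (uM i (ℕ.suc k))) (literal-0-0 b)) (trans (ℚ.*-identityˡ _) (⟦⟧-uM a i k))

⟦⟧-ubarM : ∀ {n} (a : Vec Bool n) i → ⟦ a ⟧ (ubarM i) ≡ bit (not (lookup a i))
⟦⟧-ubarM (true ∷ a) zero = ℚ.*-zeroˡ (⟦ a ⟧ oneM)
⟦⟧-ubarM (false ∷ a) zero = trans (ℚ.*-identityˡ _) (⟦⟧-oneM a)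
⟦⟧-ubarM (b ∷ a) (suc i) =
  trans (cong (_*ℚ ⟦ a ⟧ (ubarM i)) (literal-0-0 b)) (trans (ℚ.*-identityˡ _) (⟦⟧-ubarM a i))

allFalse : ∀ {n} → Vec Bool n → ℚ
allFalse [] = 1ℚ
allFalse (true ∷ a) = 0ℚ
allFalse (false ∷ a) = allFalse a

⟦⟧-∏ū : ∀ {n} (a : Vec Bool n) → ⟦ a ⟧ (replicate n 0 , replicate n 1) ≡ allFalse a
⟦⟧-∏ū [] = refl
⟦⟧-∏ū (true ∷ a) = ℚ.*-zeroˡ (⟦ a ⟧ (replicate _ 0 , replicate _ 1))
⟦⟧-∏ū (false ∷ a) = trans (ℚ.*-identityˡ _) (⟦⟧-∏ū a)

pointValue-[]≔ : ∀ {n} (a : Vec Bool n) i b xs ys → lookup xs i ≡ 0 → lookup ys i ≡ 0 →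
  pointValue (a [ i ]≔ b) xs ys ≡ pointValue a xs ys
pointValue-[]≔ (c ∷ a) zero b (.0 ∷ xs) (.0 ∷ ys) refl refl =
  cong (_*ℚ pointValue a xs ys) (trans (literal-0-0 b) (sym (literal-0-0 c)))
pointValue-[]≔ (c ∷ a) (suc i) b (x ∷ xs) (y ∷ ys) xᵢ≡0 yᵢ≡0 =
  cong (literal c x y *ℚ_) (pointValue-[]≔ a i b xs ys xᵢ≡0 yᵢ≡0)

⟦⟧-[]≔ : ∀ {n} (a : Vec Bool n) i b e → OnlyLeftOf i e → ⟦ a [ i ]≔ b ⟧ e ≡ ⟦ a ⟧ e
⟦⟧-[]≔ a i b (xs , ys) left = pointValue-[]≔ a i b xs ys (proj₁ left-of-i) (proj₂ left-of-i)
  where left-of-i = left i ℕ.≤-refl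

genValue : ∀ {n} → Gen n → Vec Bool n → ℚ
genValue clause a = allFalse a
genValue (boolAx _) _ = 0ℚ
genValue (compAx _) _ = 0ℚ

eval-gen : ∀ {n} (a : Vec Bool n) g → eval ⟦ a ⟧ (gen g) ≡ genValue g a
eval-gen a clause = trans (ℚ.+-identityʳ _) (trans (ℚ.*-identityˡ _) (⟦⟧-∏ū a))
eval-gen a (boolAx i) rewrite ⟦⟧-uM a i 1 | ⟦⟧-uM a i 0 = idempotent (lookup a i)
  where
  idempotent : ∀ b → 1ℚ *ℚ bit b +ℚ ((- 1ℚ) *ℚ bit b +ℚ 0ℚ) ≡ 0ℚ
  idempotent true = refl
  idempotent false = refl
eval-gen a (compAx i) rewrite ⟦⟧-uM a i 0 | ⟦⟧-ubarM a i | ⟦⟧-oneM a = complementary (lookup a i)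
  where
  complementary : ∀ b → 1ℚ *ℚ bit b +ℚ (1ℚ *ℚ bit (not b) +ℚ ((- 1ℚ) *ℚ 1ℚ +ℚ 0ℚ)) ≡ 0ℚ
  complementary true = refl
  complementary false = refl

sign : Bool → ℚ
sign true = - 1ℚ
sign false = 1ℚ

eval-oneMinus2u : ∀ {n} (a : Vec Bool n) i → eval ⟦ a ⟧ (oneMinus2u i) ≡ sign (lookup a i)
eval-oneMinus2u a i rewrite ⟦⟧-oneM a | ⟦⟧-uM a i 0 = one-minus-twice (lookup a i)
  where
  one-minus-twice : ∀ b → 1ℚ *ℚ 1ℚ +ℚ ((- (1ℚ +ℚ 1ℚ)) *ℚ bit b +ℚ 0ℚ) ≡ sign b
  one-minus-twice true = refl
  one-minus-twice false = refl

-1≤bit : ∀ {v} → IsBit v → - 1ℚ ≤ℚ 1ℚ *ℚ v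
-1≤bit (inj₁ refl) = toWitness {a? = - 1ℚ ℚ.≤? 1ℚ *ℚ 0ℚ} tt
-1≤bit (inj₂ refl) = toWitness {a? = - 1ℚ ℚ.≤? 1ℚ *ℚ 1ℚ} tt

-1≤-bit : ∀ {v} → IsBit v → - 1ℚ ≤ℚ (- 1ℚ) *ℚ v
-1≤-bit (inj₁ refl) = toWitness {a? = - 1ℚ ℚ.≤? (- 1ℚ) *ℚ 0ℚ} tt
-1≤-bit (inj₂ refl) = toWitness {a? = - 1ℚ ℚ.≤? (- 1ℚ) *ℚ 1ℚ} tt

-suc≤-+ : ∀ k {x y} → - 1ℚ ≤ℚ x → - fromℕ k ≤ℚ y → - fromℕ (ℕ.suc k) ≤ℚ x +ℚ y
-suc≤-+ k -1≤x -k≤y = ℚ.≤-trans (ℚ.≤-reflexive (ℚ.neg-distrib-+ 1ℚ (fromℕ k))) (ℚ.+-mono-≤ -1≤x -k≤y)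

eval-unary-≥ : ∀ {n} (a : Vec Bool n) q → - fromℕ (length q) ≤ℚ eval ⟦ a ⟧ (toPoly q)
eval-unary-≥ a [] = ℚ.≤-refl
eval-unary-≥ a ((true , e) ∷ q) = -suc≤-+ (length q) (-1≤bit (⟦⟧-IsBit a e)) (eval-unary-≥ a q)
eval-unary-≥ a ((false , e) ∷ q) = -suc≤-+ (length q) (-1≤-bit (⟦⟧-IsBit a e)) (eval-unary-≥ a q)

Σcube : ∀ n → (Vec Bool n → ℚ) → ℚ
Σcube ℕ.zero f = f []
Σcube (ℕ.suc n) f = Σcube n (λ a → f (true ∷ a)) +ℚ Σcube n (λ a → f (false ∷ a))

Σcube-cong : ∀ n {f g : Vec Bool n → ℚ} → (∀ a → f a ≡ g a) → Σcube n f ≡ Σcube n g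
Σcube-cong ℕ.zero f≗g = f≗g []
Σcube-cong (ℕ.suc n) f≗g =
  cong₂ _+ℚ_ (Σcube-cong n (λ a → f≗g (true ∷ a))) (Σcube-cong n (λ a → f≗g (false ∷ a)))

Σcube-+ : ∀ n (f g : Vec Bool n → ℚ) → Σcube n (λ a → f a +ℚ g a) ≡ Σcube n f +ℚ Σcube n g
Σcube-+ ℕ.zero f g = refl
Σcube-+ (ℕ.suc n) f g =
  trans (cong₂ _+ℚ_ (Σcube-+ n (λ a → f (true ∷ a)) (λ a → g (true ∷ a)))
                    (Σcube-+ n (λ a → f (false ∷ a)) (λ a → g (false ∷ a))))
        (+-interchange (Σcube n (λ a → f (true ∷ a))) _ _ _)

Σcube-neg : ∀ n (f : Vec Bool n → ℚ) → Σcube n (λ a → - f a) ≡ - Σcube n f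
Σcube-neg ℕ.zero f = refl
Σcube-neg (ℕ.suc n) f =
  trans (cong₂ _+ℚ_ (Σcube-neg n (λ a → f (true ∷ a))) (Σcube-neg n (λ a → f (false ∷ a))))
        (sym (ℚ.neg-distrib-+ (Σcube n (λ a → f (true ∷ a))) _))

Σcube-0 : ∀ n → Σcube n (λ _ → 0ℚ) ≡ 0ℚ
Σcube-0 ℕ.zero = refl
Σcube-0 (ℕ.suc n) = trans (cong₂ _+ℚ_ (Σcube-0 n) (Σcube-0 n)) (ℚ.+-identityʳ 0ℚ)

fromℕ-+ : ∀ k l → fromℕ (k ℕ.+ l) ≡ fromℕ k +ℚ fromℕ l
fromℕ-+ ℕ.zero l = sym (ℚ.+-identityˡ _)
fromℕ-+ (ℕ.suc k) l = trans (cong (1ℚ +ℚ_) (fromℕ-+ k l)) (sym (ℚ.+-assoc 1ℚ (fromℕ k) (fromℕ l)))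

Σcube-1 : ∀ n → Σcube n (λ _ → 1ℚ) ≡ fromℕ (2 ^ n)
Σcube-1 ℕ.zero = refl
Σcube-1 (ℕ.suc n) = begin
  Σcube n (λ _ → 1ℚ) +ℚ Σcube n (λ _ → 1ℚ)     ≡⟨ cong₂ _+ℚ_ (Σcube-1 n) (Σcube-1 n) ⟩
  fromℕ (2 ^ n) +ℚ fromℕ (2 ^ n)               ≡⟨ sym (fromℕ-+ (2 ^ n) (2 ^ n)) ⟩
  fromℕ (2 ^ n ℕ.+ 2 ^ n)                      ≡⟨ cong fromℕ (cong (2 ^ n ℕ.+_) (sym (ℕ.+-identityʳ (2 ^ n)))) ⟩
  fromℕ (2 ^ ℕ.suc n)                          ∎
  where open ≡-Reasoning

Σcube-sumℚ : ∀ {A : Set} n (f : A → Vec Bool n → ℚ) xs →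
  Σcube n (λ a → sumℚ (map (λ x → f x a) xs)) ≡ sumℚ (map (λ x → Σcube n (f x)) xs)
Σcube-sumℚ n f [] = Σcube-0 n
Σcube-sumℚ n f (x ∷ xs) =
  trans (Σcube-+ n (f x) (λ a → sumℚ (map (λ y → f y a) xs))) (cong (Σcube n (f x) +ℚ_) (Σcube-sumℚ n f xs))

Σcube-nonNeg : ∀ n (f : Vec Bool n → ℚ) → (∀ a → 0ℚ ≤ℚ f a) → 0ℚ ≤ℚ Σcube n f
Σcube-nonNeg ℕ.zero f f≥0 = f≥0 []
Σcube-nonNeg (ℕ.suc n) f f≥0 =
  ℚ.+-mono-≤ (Σcube-nonNeg n _ (λ a → f≥0 (true ∷ a))) (Σcube-nonNeg n _ (λ a → f≥0 (false ∷ a)))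

Σcube-allFalse : ∀ n (g : Vec Bool n → ℚ) → Σcube n (λ a → g a *ℚ allFalse a) ≡ g (replicate n false)
Σcube-allFalse ℕ.zero g = ℚ.*-identityʳ (g [])
Σcube-allFalse (ℕ.suc n) g = begin
  Σcube n (λ a → g (true ∷ a) *ℚ 0ℚ) +ℚ Σcube n (λ a → g (false ∷ a) *ℚ allFalse a)
    ≡⟨ cong₂ _+ℚ_ (trans (Σcube-cong n (λ a → ℚ.*-zeroʳ (g (true ∷ a)))) (Σcube-0 n))
                  (Σcube-allFalse n (λ a → g (false ∷ a))) ⟩
  0ℚ +ℚ g (false ∷ replicate n false)
    ≡⟨ ℚ.+-identityˡ _ ⟩
  g (replicate (ℕ.suc n) false) ∎
  where open ≡-Reasoning

IgnoresCoordinate : ∀ {n} → Fin n → (Vec Bool n → ℚ) → Set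
IgnoresCoordinate i G = ∀ a b → G (a [ i ]≔ b) ≡ G a

-- Pair each point with the one differing only in coordinate i: the two summands cancel.
Σcube-odd : ∀ n i (G : Vec Bool n → ℚ) (h : Bool → ℚ) → IgnoresCoordinate i G → h true ≡ - h false →
  Σcube n (λ a → G a *ℚ h (lookup a i)) ≡ 0ℚ
Σcube-odd (ℕ.suc n) zero G h ignores h-odd = begin
  Σcube n (λ a → G (true ∷ a) *ℚ h true) +ℚ Σcube n (λ a → G (false ∷ a) *ℚ h false)
    ≡⟨ cong (_+ℚ Σcube n (λ a → G (false ∷ a) *ℚ h false)) (trans (Σcube-cong n flip) (Σcube-neg n _)) ⟩
  - Σcube n (λ a → G (false ∷ a) *ℚ h false) +ℚ Σcube n (λ a → G (false ∷ a) *ℚ h false)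
    ≡⟨ ℚ.+-inverseˡ (Σcube n (λ a → G (false ∷ a) *ℚ h false)) ⟩
  0ℚ ∎
  where
  open ≡-Reasoning
  flip : ∀ a → G (true ∷ a) *ℚ h true ≡ - (G (false ∷ a) *ℚ h false)
  flip a = trans (cong₂ _*ℚ_ (ignores (false ∷ a) true) h-odd) (sym (ℚ.neg-distribʳ-* (G (false ∷ a)) (h false)))
Σcube-odd (ℕ.suc n) (suc i) G h ignores h-odd =
  trans (cong₂ _+ℚ_ (Σcube-odd n i (λ a → G (true ∷ a)) h (λ a → ignores (true ∷ a)) h-odd)
                    (Σcube-odd n i (λ a → G (false ∷ a)) h (λ a → ignores (false ∷ a)) h-odd))
        (ℚ.+-identityʳ 0ℚ)

cubeSum : ∀ {n} → Poly n → ℚ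
cubeSum {n} p = Σcube n (λ a → eval ⟦ a ⟧ p)

cubeSum-++ : ∀ {n} (p q : Poly n) → cubeSum (p ++ q) ≡ cubeSum p +ℚ cubeSum q
cubeSum-++ {n} p q = trans (Σcube-cong n (λ a → eval-++ ⟦ a ⟧ p q)) (Σcube-+ n _ _)

cubeSum-IsZero : ∀ {n} (p : Poly n) → IsZero p → cubeSum p ≡ 0ℚ
cubeSum-IsZero {n} p p≡0 = trans (Σcube-cong n (λ a → eval-IsZero ⟦ a ⟧ p p≡0)) (Σcube-0 n)

cubeSum-1 : ∀ n → cubeSum {n} ((1ℚ , oneM) ∷ []) ≡ fromℕ (2 ^ n)
cubeSum-1 n = trans (Σcube-cong n one) (Σcube-1 n)
  where
  one : ∀ a → eval ⟦ a ⟧ ((1ℚ , oneM) ∷ []) ≡ 1ℚ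
  one a = trans (ℚ.+-identityʳ _) (trans (ℚ.*-identityˡ _) (⟦⟧-oneM a))

module _ {n : ℕ} (R : UnaryRefutation n) where
  open UnaryRefutation R

  generatorPart universalPart squarePart : Poly n
  generatorPart = sumPoly (map (λ g → toPoly (qgen g) ⊗ gen g) (allGen n))
  universalPart = sumPoly (map (λ i → toPoly (quni i) ⊗ oneMinus2u i) (allFin n))
  squarePart = sumPoly (map (λ s → toPoly s ⊗ toPoly s) squares)

  multiplier : ∀ {A : Set} → (A → UPoly n) → A → Vec Bool n → ℚ
  multiplier q x a = eval ⟦ a ⟧ (toPoly (q x))

  eval-generatorTerm : ∀ a g → eval ⟦ a ⟧ (toPoly (qgen g) ⊗ gen g) ≡ multiplier qgen g a *ℚ genValue g a
  eval-generatorTerm a g =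
    trans (eval-⊗ ⟦ a ⟧ (⟦⟧-multiplicative a) (toPoly (qgen g)) (gen g))
          (cong (multiplier qgen g a *ℚ_) (eval-gen a g))

  eval-generatorPart : ∀ a → eval ⟦ a ⟧ generatorPart ≡ multiplier qgen clause a *ℚ allFalse a
  eval-generatorPart a = begin
    eval ⟦ a ⟧ generatorPart
      ≡⟨ eval-concat ⟦ a ⟧ (λ g → toPoly (qgen g) ⊗ gen g) (allGen n) ⟩
    term clause +ℚ sumℚ (map term axioms)
      ≡⟨ cong₂ _+ℚ_ (eval-generatorTerm a clause) (sumℚ-All-0 term axiom-terms-vanish) ⟩
    multiplier qgen clause a *ℚ allFalse a +ℚ 0ℚ
      ≡⟨ ℚ.+-identityʳ _ ⟩
    multiplier qgen clause a *ℚ allFalse a ∎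
    where
    open ≡-Reasoning
    term : Gen n → ℚ
    term g = eval ⟦ a ⟧ (toPoly (qgen g) ⊗ gen g)
    axioms : List (Gen n)
    axioms = map boolAx (allFin n) ++ map compAx (allFin n)
    axiom-term-vanishes : ∀ g → genValue g a ≡ 0ℚ → term g ≡ 0ℚ
    axiom-term-vanishes g value≡0 =
      trans (eval-generatorTerm a g) (trans (cong (multiplier qgen g a *ℚ_) value≡0) (ℚ.*-zeroʳ (multiplier qgen g a)))
    axiom-terms-vanish : All (λ g → term g ≡ 0ℚ) axioms
    axiom-terms-vanish =
      ++⁺ (map⁺ (All.universal (λ i → axiom-term-vanishes (boolAx i) refl) (allFin n)))
          (map⁺ (All.universal (λ i → axiom-term-vanishes (compAx i) refl) (allFin n)))

  cubeSum-generatorPart : cubeSum generatorPart ≡ multiplier qgen clause (replicate n false)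
  cubeSum-generatorPart =
    trans (Σcube-cong n eval-generatorPart) (Σcube-allFalse n (multiplier qgen clause))

  -- This is where the quantifier condition on q_u enters.
  multiplier-ignores : ∀ i → IgnoresCoordinate i (multiplier quni i)
  multiplier-ignores i a b = eval-cong-support ⟦ a [ i ]≔ b ⟧ ⟦ a ⟧ (toPoly (quni i))
    (λ e nonzero → ⟦⟧-[]≔ a i b e (quni-ok i e nonzero))

  cubeSum-universalPart : cubeSum universalPart ≡ 0ℚ
  cubeSum-universalPart = begin
    cubeSum universalPart
      ≡⟨ Σcube-cong n eval-universalPart ⟩
    Σcube n (λ a → sumℚ (map (λ i → term i a) (allFin n)))
      ≡⟨ Σcube-sumℚ n term (allFin n) ⟩
    sumℚ (map (λ i → Σcube n (term i)) (allFin n))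
      ≡⟨ sumℚ-All-0 (λ i → Σcube n (term i)) (All.universal cancels (allFin n)) ⟩
    0ℚ ∎
    where
    open ≡-Reasoning
    term : Fin n → Vec Bool n → ℚ
    term i a = multiplier quni i a *ℚ sign (lookup a i)
    eval-universalPart : ∀ a → eval ⟦ a ⟧ universalPart ≡ sumℚ (map (λ i → term i a) (allFin n))
    eval-universalPart a =
      trans (eval-concat ⟦ a ⟧ (λ i → toPoly (quni i) ⊗ oneMinus2u i) (allFin n))
            (cong sumℚ (map-cong (λ i →
              trans (eval-⊗ ⟦ a ⟧ (⟦⟧-multiplicative a) (toPoly (quni i)) (oneMinus2u i))
                    (cong (multiplier quni i a *ℚ_) (eval-oneMinus2u a i))) (allFin n)))
    cancels : ∀ i → Σcube n (term i) ≡ 0ℚ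
    cancels i = Σcube-odd n i (multiplier quni i) sign (multiplier-ignores i) refl

  cubeSum-squarePart-nonNeg : 0ℚ ≤ℚ cubeSum squarePart
  cubeSum-squarePart-nonNeg = Σcube-nonNeg n _ λ a →
    ℚ.≤-trans (sumℚ-nonNeg _ squares λ s →
                 ℚ.≤-trans (*-self-nonNeg (eval ⟦ a ⟧ (toPoly s)))
                           (ℚ.≤-reflexive (sym (eval-⊗ ⟦ a ⟧ (⟦⟧-multiplicative a) (toPoly s) (toPoly s)))))
              (ℚ.≤-reflexive (sym (eval-concat ⟦ a ⟧ (λ s → toPoly s ⊗ toPoly s) squares)))

  cubeSum-refutation : multiplier qgen clause (replicate n false) +ℚ (cubeSum squarePart +ℚ fromℕ (2 ^ n)) ≡ 0ℚ
  cubeSum-refutation = begin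
    Q +ℚ (S +ℚ fromℕ (2 ^ n))
      ≡⟨ cong (Q +ℚ_) (ℚ.+-identityˡ (S +ℚ fromℕ (2 ^ n))) ⟨
    Q +ℚ (0ℚ +ℚ (S +ℚ fromℕ (2 ^ n)))
      ≡⟨ cong₂ _+ℚ_ cubeSum-generatorPart (cong₂ _+ℚ_ cubeSum-universalPart (cong (S +ℚ_) (cubeSum-1 n))) ⟨
    cubeSum generatorPart +ℚ (cubeSum universalPart +ℚ (S +ℚ cubeSum unit))
      ≡⟨ cong (cubeSum generatorPart +ℚ_) (cong (cubeSum universalPart +ℚ_) (cubeSum-++ squarePart unit)) ⟨
    cubeSum generatorPart +ℚ (cubeSum universalPart +ℚ cubeSum (squarePart ++ unit))
      ≡⟨ cong (cubeSum generatorPart +ℚ_) (cubeSum-++ universalPart (squarePart ++ unit)) ⟨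
    cubeSum generatorPart +ℚ cubeSum (universalPart ++ (squarePart ++ unit))
      ≡⟨ cubeSum-++ generatorPart (universalPart ++ (squarePart ++ unit)) ⟨
    cubeSum (generatorPart ++ (universalPart ++ (squarePart ++ unit)))
      ≡⟨ cubeSum-IsZero (generatorPart ++ (universalPart ++ (squarePart ++ unit))) identity ⟩
    0ℚ ∎
    where
    open ≡-Reasoning
    Q = multiplier qgen clause (replicate n false)
    S = cubeSum squarePart
    unit : Poly n
    unit = (1ℚ , oneM) ∷ []

  clauseMultiplier-length : 2 ^ n ≤ length (qgen clause)
  clauseMultiplier-length = fromℕ-cancel-≤ (2 ^ n) (length (qgen clause)) (begin
    fromℕ (2 ^ n)
      ≤⟨ sum≡0⇒≤-neg _ _ _ cubeSum-refutation cubeSum-squarePart-nonNeg ⟩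
    - multiplier qgen clause (replicate n false)
      ≤⟨ ℚ.neg-antimono-≤ (eval-unary-≥ (replicate n false) (qgen clause)) ⟩
    - - fromℕ (length (qgen clause))
      ≡⟨ ⁻¹-involutive _ ⟩
    fromℕ (length (qgen clause)) ∎)
    where open ℚ.≤-Reasoning

  clauseMultiplier-≤-size : length (qgen clause) ≤ size
  clauseMultiplier-≤-size = ℕ.≤-trans (ℕ.m≤m+n (length (qgen clause)) _) (ℕ.m≤m+n _ _)

proposition3p5 : ∃[ c ] ∃[ d ] ∀ (n : ℕ) (R : UnaryRefutation n) →
    2 ^ n ≤ c * UnaryRefutation.size R ^ d
proposition3p5 = 1 , 1 , λ n R → begin
  2 ^ n                                   ≤⟨ clauseMultiplier-length R ⟩
  length (UnaryRefutation.qgen R clause)  ≤⟨ clauseMultiplier-≤-size R ⟩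
  UnaryRefutation.size R                  ≡⟨ ℕ.*-identityʳ _ ⟨
  UnaryRefutation.size R * 1              ≡⟨ ℕ.*-identityˡ _ ⟨
  1 * (UnaryRefutation.size R * 1)        ∎
  where open ℕ.≤-Reasoning
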